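{- For every formula $A$ of $\mathsf{IL}^\omega$, $(|A^{+}|^{\mathbf x}_{\mathbf y} \multimap (A_D(\mathbf x;\mathbf y))^{+}) \,\&\, ((A_D(\mathbf x;\mathbf y))^{+} \multimap |A^{+}|^{\mathbf x}_{\mathbf y})$ is provable, where $A_D(\mathbf x;\mathbf y)$ is the quantifier-free matrix of Gödel's Dialectica interpretation of $A$.
   Context: The translation $A^{+}$ of $\mathsf{IL}^\omega$ into linear logic: $A_{\mathrm{at}}^{+} :\equiv A_{\mathrm{at}}$ ($A_{\mathrm{at}}\not\equiv\bot$); $\bot^{+} :\equiv 0$; $(A\wedge B)^{+} :\equiv A^{+}\,\&\,B^{+}$; $(A\vee B)^{+} :\equiv A^{+}\oplus B^{+}$; $(A\to B)^{+} :\equiv \mathord{!}A^{+}\multimap B^{+}$; $(\forall x A)^{+} :\equiv \forall x A^{+}$; $(\exists x A)^{+} :\equiv \exists x A^{+}$ (sound into $\mathsf{ILL}^\omega_r$ plus $\mathord{!}(A\oplus B)\multimap\mathord{!}A\oplus\mathord{!}B$ and $\mathord{!}\exists xA\multimap\exists x\mathord{!}A$, which are interpretable). The verifying system $\mathsf{ILL}^\omega_b$ is intuitionistic linear logic over finite types plus booleans $\mathsf{T},\mathsf{F}$, equality $=^b$, conditional terms and axioms ensuring $\mathsf{T}\ne\mathsf{F}$ and every boolean is $\mathsf{T}$ or $\mathsf{F}$; $\mathrm{cond}_z(A,B) :\equiv (\mathord{!}(z=^b\mathsf{T}) \multimap A) \,\&\, (\mathord{!}(z=^b\mathsf{F}) \multimap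 B)$. The interpretation: $|A_{\mathrm{at}}|:\equiv A_{\mathrm{at}}$; $|A \multimap B|^{\mathbf f,\mathbf g}_{\mathbf x,\mathbf w} :\equiv |A|^{\mathbf x}_{\mathbf f\mathbf x\mathbf w} \multimap |B|^{\mathbf g\mathbf x}_{\mathbf w}$; $|A\otimes B|^{\mathbf x,\mathbf v}_{\mathbf y,\mathbf w} :\equiv |A|^{\mathbf x}_{\mathbf y}\otimes|B|^{\mathbf v}_{\mathbf w}$; $|A\,\&\,B|^{\mathbf x,\mathbf v}_{\mathbf y,\mathbf w} :\equiv |A|^{\mathbf x}_{\mathbf y}\,\&\,|B|^{\mathbf v}_{\mathbf w}$; $|A\oplus B|^{\mathbf x,\mathbf v,z}_{\mathbf y,\mathbf w} :\equiv \mathrm{cond}_z(|A|^{\mathbf x}_{\mathbf y},|B|^{\mathbf v}_{\mathbf w})$; $|\exists z A(z)|^{\mathbf x,z}_{\mathbf y} :\equiv |A(z)|^{\mathbf x}_{\mathbf y}$; $|\forall z A(z)|^{\mathbf f}_{\mathbf y,z} :\equiv |A(z)|^{\mathbf f z}_{\mathbf y}$; and, Dialectica style, $|\mathord{!}A|^{\mathbf x}_{\mathbf y} :\equiv \mathord{!}\,|A|^{\mathbf x}_{\mathbf y}$ (requires decidability of quantifier-free formulas and definition by cases in the verifying system). Dialectica disjunction: $(A\vee B)_D(\mathbf x,\mathbf v,z;\mathbf y,\mathbf w)\equiv(z=\mathsf{T}\to A_D(\mathbf x;\mathbf y))\wedge(z=\mathsf{F}\to B_D(\mathbf v;\mathbf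 w))$. -}

module Defs where

open import Data.List using (List; []; _∷_; _++_; map; [_])
open import Data.List.Relation.Unary.All using (All; []; _∷_)
open import Data.List.Relation.Binary.Permutation.Propositional using (_↭_)
open import Data.Product using (_×_; _,_)
open import Relation.Binary.PropositionalEquality using (_≡_; refl; subst; sym; cong; cong₂)

infixr 7 _⇒_
data Ty : Set where
  ι   : Ty
  𝔹   : Ty
  _⇒_ : Ty → Ty → Ty

-- types at which equality is an atomic formula (type 0 and booleans)
data Base : Ty → Set where
  ι : Base ι
  𝔹 : Base 𝔹

Ctx : Set
Ctx = List Ty

data _∋_ : Ctx → Ty → Set where
  here  : ∀ {Γ σ} → (σ ∷ Γ) ∋ σ
  there : ∀ {Γ σ τ} → Γ ∋ σ → (τ ∷ Γ) ∋ σ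

data Tm (Γ : Ctx) : Ty → Set where
  var  : ∀ {σ} → Γ ∋ σ → Tm Γ σ
  app  : ∀ {σ τ} → Tm Γ (σ ⇒ τ) → Tm Γ σ → Tm Γ τ
  tt   : Tm Γ 𝔹
  ff   : Tm Γ 𝔹
  cond : ∀ {σ} → Tm Γ 𝔹 → Tm Γ σ → Tm Γ σ → Tm Γ σ

Ren : Ctx → Ctx → Set
Ren Γ Δ = ∀ {σ} → Γ ∋ σ → Δ ∋ σ

extR : ∀ {Γ Δ τ} → Ren Γ Δ → Ren (τ ∷ Γ) (τ ∷ Δ)
extR ρ here      = here
extR ρ (there x) = there (ρ x)

ren : ∀ {Γ Δ σ} → Ren Γ Δ → Tm Γ σ → Tm Δ σ
ren ρ (var x)      = var (ρ x)
ren ρ (app t u)    = app (ren ρ t) (ren ρ u)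
ren ρ tt           = tt
ren ρ ff           = ff
ren ρ (cond b t u) = cond (ren ρ b) (ren ρ t) (ren ρ u)

Sub : Ctx → Ctx → Set
Sub Γ Δ = ∀ {σ} → Γ ∋ σ → Tm Δ σ

extS : ∀ {Γ Δ τ} → Sub Γ Δ → Sub (τ ∷ Γ) (τ ∷ Δ)
extS s here      = var here
extS s (there x) = ren there (s x)

sub : ∀ {Γ Δ σ} → Sub Γ Δ → Tm Γ σ → Tm Δ σ
sub s (var x)      = s x
sub s (app t u)    = app (sub s t) (sub s u)
sub s tt           = tt
sub s ff           = ff
sub s (cond b t u) = cond (sub s b) (sub s t) (sub s u)

single : ∀ {Γ σ} → Tm Γ σ → Sub (σ ∷ Γ) Γ
single t here      = t
single t (there x) = var x

Tms : Ctx → List Ty → Set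
Tms Γ Ts = All (Tm Γ) Ts

wkTms : ∀ {Γ τ Ts} → Tms Γ Ts → Tms (τ ∷ Γ) Ts
wkTms []       = []
wkTms (t ∷ ts) = ren there t ∷ wkTms ts

_++ᵗ_ : ∀ {Γ Xs Ys} → Tms Γ Xs → Tms Γ Ys → Tms Γ (Xs ++ Ys)
[]       ++ᵗ ys = ys
(x ∷ xs) ++ᵗ ys = x ∷ (xs ++ᵗ ys)

split : ∀ {Γ} Xs {Ys} → Tms Γ (Xs ++ Ys) → Tms Γ Xs × Tms Γ Ys
split []       ts       = [] , ts
split (X ∷ Xs) (t ∷ ts) with split Xs ts
... | xs , ys = (t ∷ xs) , ys

infixr 7 _⇒*_
_⇒*_ : List Ty → Ty → Ty
[]       ⇒* τ = τ
(σ ∷ Xs) ⇒* τ = σ ⇒ (Xs ⇒* τ)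

app* : ∀ {Γ Xs τ} → Tm Γ (Xs ⇒* τ) → Tms Γ Xs → Tm Γ τ
app* t []       = t
app* t (u ∷ us) = app* (app t u) us

applyTup : ∀ {Γ} Xs Ys → Tms Γ (map (Xs ⇒*_) Ys) → Tms Γ Xs → Tms Γ Ys
applyTup Xs []       []       xs = []
applyTup Xs (Y ∷ Ys) (f ∷ fs) xs = app* f xs ∷ applyTup Xs Ys fs xs

data Atom (Γ : Ctx) : Set where
  eq : ∀ {σ} → Base σ → Tm Γ σ → Tm Γ σ → Atom Γ

subA : ∀ {Γ Δ} → Sub Γ Δ → Atom Γ → Atom Δ
subA s (eq b t u) = eq b (sub s t) (sub s u)

renA : ∀ {Γ Δ} → Ren Γ Δ → Atom Γ → Atom Δ
renA ρ (eq b t u) = eq b (ren ρ t) (ren ρ u)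

infixr 9 _∧_
infixr 8 _∨_
infixr 7 _⊃_
data Fm (Γ : Ctx) : Set where
  atom : Atom Γ → Fm Γ
  ⊥'   : Fm Γ
  _∧_  : Fm Γ → Fm Γ → Fm Γ
  _∨_  : Fm Γ → Fm Γ → Fm Γ
  _⊃_  : Fm Γ → Fm Γ → Fm Γ
  all  : (σ : Ty) → Fm (σ ∷ Γ) → Fm Γ
  ex   : (σ : Ty) → Fm (σ ∷ Γ) → Fm Γ

infixr 9 _⊗_ _&_
infixr 8 _⊕_
infixr 7 _⊸_
data LFm (Γ : Ctx) : Set where
  atom : Atom Γ → LFm Γ
  𝟘    : LFm Γ
  𝟙    : LFm Γ
  ⊤'   : LFm Γ
  _⊗_  : LFm Γ → LFm Γ → LFm Γ
  _&_  : LFm Γ → LFm Γ → LFm Γ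
  _⊕_  : LFm Γ → LFm Γ → LFm Γ
  _⊸_  : LFm Γ → LFm Γ → LFm Γ
  !_   : LFm Γ → LFm Γ
  all  : (σ : Ty) → LFm (σ ∷ Γ) → LFm Γ
  ex   : (σ : Ty) → LFm (σ ∷ Γ) → LFm Γ

renL : ∀ {Γ Δ} → Ren Γ Δ → LFm Γ → LFm Δ
renL ρ (atom a) = atom (renA ρ a)
renL ρ 𝟘        = 𝟘
renL ρ 𝟙        = 𝟙
renL ρ ⊤'       = ⊤'
renL ρ (A ⊗ B)  = renL ρ A ⊗ renL ρ B
renL ρ (A & B)  = renL ρ A & renL ρ B
renL ρ (A ⊕ B)  = renL ρ A ⊕ renL ρ B
renL ρ (A ⊸ B)  = renL ρ A ⊸ renL ρ B
renL ρ (! A)    = ! renL ρ A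
renL ρ (all σ A) = all σ (renL (extR ρ) A)
renL ρ (ex σ A)  = ex σ (renL (extR ρ) A)

subL : ∀ {Γ Δ} → Sub Γ Δ → LFm Γ → LFm Δ
subL s (atom a) = atom (subA s a)
subL s 𝟘        = 𝟘
subL s 𝟙        = 𝟙
subL s ⊤'       = ⊤'
subL s (A ⊗ B)  = subL s A ⊗ subL s B
subL s (A & B)  = subL s A & subL s B
subL s (A ⊕ B)  = subL s A ⊕ subL s B
subL s (A ⊸ B)  = subL s A ⊸ subL s B
subL s (! A)    = ! subL s A
subL s (all σ A) = all σ (subL (extS s) A)
subL s (ex σ A)  = ex σ (subL (extS s) A)

subF : ∀ {Γ Δ} → Sub Γ Δ → Fm Γ → Fm Δ
subF s (atom a) = atom (subA s a)
subF s ⊥'       = ⊥'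
subF s (A ∧ B)  = subF s A ∧ subF s B
subF s (A ∨ B)  = subF s A ∨ subF s B
subF s (A ⊃ B)  = subF s A ⊃ subF s B
subF s (all σ A) = all σ (subF (extS s) A)
subF s (ex σ A)  = ex σ (subF (extS s) A)

wkL : ∀ {Γ τ} → LFm Γ → LFm (τ ∷ Γ)
wkL = renL there

_[_]L : ∀ {Γ σ} → LFm (σ ∷ Γ) → Tm Γ σ → LFm Γ
A [ t ]L = subL (single t) A

_[_]F : ∀ {Γ σ} → Fm (σ ∷ Γ) → Tm Γ σ → Fm Γ
A [ t ]F = subF (single t) A

infix 15 _⁺
_⁺ : ∀ {Γ} → Fm Γ → LFm Γ
atom a ⁺  = atom a
⊥' ⁺      = 𝟘
(A ∧ B) ⁺ = A ⁺ & B ⁺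
(A ∨ B) ⁺ = A ⁺ ⊕ B ⁺
(A ⊃ B) ⁺ = (! (A ⁺)) ⊸ B ⁺
all σ A ⁺ = all σ (A ⁺)
ex σ A ⁺  = ex σ (A ⁺)

-- Gödel's Dialectica interpretation: A^D = ∃x ∀y A_D(x;y)

D⁺ : ∀ {Γ} → Fm Γ → List Ty
D⁻ : ∀ {Γ} → Fm Γ → List Ty
D⁺ (atom a)  = []
D⁺ ⊥'        = []
D⁺ (A ∧ B)   = D⁺ A ++ D⁺ B
D⁺ (A ∨ B)   = D⁺ A ++ D⁺ B ++ [ 𝔹 ]
D⁺ (A ⊃ B)   = map ((D⁺ A ++ D⁻ B) ⇒*_) (D⁻ A) ++ map (D⁺ A ⇒*_) (D⁺ B)
D⁺ (all σ A) = map ([ σ ] ⇒*_) (D⁺ A)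
D⁺ (ex σ A)  = D⁺ A ++ [ σ ]
D⁻ (atom a)  = []
D⁻ ⊥'        = []
D⁻ (A ∧ B)   = D⁻ A ++ D⁻ B
D⁻ (A ∨ B)   = D⁻ A ++ D⁻ B
D⁻ (A ⊃ B)   = D⁺ A ++ D⁻ B
D⁻ (all σ A) = D⁻ A ++ [ σ ]
D⁻ (ex σ A)  = D⁻ A

_D[_⨾_] : ∀ {Γ} (A : Fm Γ) → Tms Γ (D⁺ A) → Tms Γ (D⁻ A) → Fm Γ
atom a D[ [] ⨾ [] ] = atom a
⊥' D[ [] ⨾ [] ] = ⊥'
(A ∧ B) D[ xv ⨾ yw ] with split (D⁺ A) xv | split (D⁻ A) yw
... | x , v | y , w = A D[ x ⨾ y ] ∧ B D[ v ⨾ w ]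
(A ∨ B) D[ xvz ⨾ yw ] with split (D⁺ A) xvz | split (D⁻ A) yw
... | x , vz | y , w with split (D⁺ B) vz
... | v , (z ∷ []) =
  (atom (eq 𝔹 z tt) ⊃ A D[ x ⨾ y ]) ∧ (atom (eq 𝔹 z ff) ⊃ B D[ v ⨾ w ])
(A ⊃ B) D[ fg ⨾ xw ] with split (map ((D⁺ A ++ D⁻ B) ⇒*_) (D⁻ A)) fg | split (D⁺ A) xw
... | f , g | x , w =
  A D[ x ⨾ applyTup (D⁺ A ++ D⁻ B) (D⁻ A) f (x ++ᵗ w) ]
    ⊃ B D[ applyTup (D⁺ A) (D⁺ B) g x ⨾ w ]
all σ A D[ f ⨾ yz ] with split (D⁻ A) yz
... | y , (z ∷ []) =
  (A D[ applyTup [ σ ] (D⁺ A) (wkTms f) (var here ∷ []) ⨾ wkTms y ]) [ z ]F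
ex σ A D[ xz ⨾ y ] with split (D⁺ A) xz
... | x , (z ∷ []) = (A D[ wkTms x ⨾ wkTms y ]) [ z ]F

W : ∀ {Γ} → LFm Γ → List Ty
C : ∀ {Γ} → LFm Γ → List Ty
W (atom a)  = []
W 𝟘         = []
W 𝟙         = []
W ⊤'        = []
W (A ⊗ B)   = W A ++ W B
W (A & B)   = W A ++ W B
W (A ⊕ B)   = W A ++ W B ++ [ 𝔹 ]
W (A ⊸ B)   = map ((W A ++ C B) ⇒*_) (C A) ++ map (W A ⇒*_) (W B)
W (! A)     = W A
W (all σ A) = map ([ σ ] ⇒*_) (W A)
W (ex σ A)  = W A ++ [ σ ]
C (atom a)  = []
C 𝟘         = []
C 𝟙         = []
C ⊤'        = []
C (A ⊗ B)   = C A ++ C B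
C (A & B)   = C A ++ C B
C (A ⊕ B)   = C A ++ C B
C (A ⊸ B)   = W A ++ C B
C (! A)     = C A
C (all σ A) = C A ++ [ σ ]
C (ex σ A)  = C A

cond_⟨_,_⟩ : ∀ {Γ} → Tm Γ 𝔹 → LFm Γ → LFm Γ → LFm Γ
cond z ⟨ A , B ⟩ = ((! atom (eq 𝔹 z tt)) ⊸ A) & ((! atom (eq 𝔹 z ff)) ⊸ B)

∣_∣ : ∀ {Γ} (A : LFm Γ) → Tms Γ (W A) → Tms Γ (C A) → LFm Γ
∣ atom a ∣ [] [] = atom a
∣ 𝟘 ∣ [] [] = 𝟘
∣ 𝟙 ∣ [] [] = 𝟙
∣ ⊤' ∣ [] [] = ⊤'
∣ A ⊗ B ∣ xv yw with split (W A) xv | split (C A) yw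
... | x , v | y , w = ∣ A ∣ x y ⊗ ∣ B ∣ v w
∣ A & B ∣ xv yw with split (W A) xv | split (C A) yw
... | x , v | y , w = ∣ A ∣ x y & ∣ B ∣ v w
∣ A ⊕ B ∣ xvz yw with split (W A) xvz | split (C A) yw
... | x , vz | y , w with split (W B) vz
... | v , (z ∷ []) = cond z ⟨ ∣ A ∣ x y , ∣ B ∣ v w ⟩
∣ A ⊸ B ∣ fg xw with split (map ((W A ++ C B) ⇒*_) (C A)) fg | split (W A) xw
... | f , g | x , w =
  ∣ A ∣ x (applyTup (W A ++ C B) (C A) f (x ++ᵗ w))
    ⊸ ∣ B ∣ (applyTup (W A) (W B) g x) w
∣ ! A ∣ x y = ! ∣ A ∣ x y
∣ all σ A ∣ f yz with split (C A) yz
... | y , (z ∷ []) =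
  (∣ A ∣ (applyTup [ σ ] (W A) (wkTms f) (var here ∷ [])) (wkTms y)) [ z ]L
∣ ex σ A ∣ xz y with split (W A) xz
... | x , (z ∷ []) = (∣ A ∣ (wkTms x) (wkTms y)) [ z ]L

W⁺ : ∀ {Γ} (A : Fm Γ) → W (A ⁺) ≡ D⁺ A
C⁺ : ∀ {Γ} (A : Fm Γ) → C (A ⁺) ≡ D⁻ A
W⁺ (atom a) = refl
W⁺ ⊥' = refl
W⁺ (A ∧ B) = cong₂ _++_ (W⁺ A) (W⁺ B)
W⁺ (A ∨ B) rewrite W⁺ A | W⁺ B = refl
W⁺ (A ⊃ B) rewrite W⁺ A | W⁺ B | C⁺ A | C⁺ B = refl
W⁺ (all σ A) rewrite W⁺ A = refl
W⁺ (ex σ A) rewrite W⁺ A = refl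
C⁺ (atom a) = refl
C⁺ ⊥' = refl
C⁺ (A ∧ B) = cong₂ _++_ (C⁺ A) (C⁺ B)
C⁺ (A ∨ B) = cong₂ _++_ (C⁺ A) (C⁺ B)
C⁺ (A ⊃ B) = cong₂ _++_ (W⁺ A) (C⁺ B)
C⁺ (all σ A) rewrite C⁺ A = refl
C⁺ (ex σ A) = C⁺ A

castW : ∀ {Γ} (A : Fm Γ) → Tms Γ (D⁺ A) → Tms Γ (W (A ⁺))
castW {Γ} A = subst (Tms Γ) (sym (W⁺ A))

castC : ∀ {Γ} (A : Fm Γ) → Tms Γ (D⁻ A) → Tms Γ (C (A ⁺))
castC {Γ} A = subst (Tms Γ) (sym (C⁺ A))

-- The verifying system ILL^ω_b: intuitionistic linear sequent calculus
-- over finite types with booleans, equality and conditional terms.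
-- Γ ⊩ Δ ⊢ A : from the multiset Δ of hypotheses (free term variables in Γ)
-- derive A.

infix 2 _⊩_⊢_
data _⊩_⊢_ (Γ : Ctx) : List (LFm Γ) → LFm Γ → Set where
  ax   : ∀ {A} → Γ ⊩ A ∷ [] ⊢ A
  cut  : ∀ {Δ₁ Δ₂ A B} → Γ ⊩ Δ₁ ⊢ A → Γ ⊩ A ∷ Δ₂ ⊢ B → Γ ⊩ Δ₁ ++ Δ₂ ⊢ B
  exch : ∀ {Δ Δ' A} → Δ ↭ Δ' → Γ ⊩ Δ ⊢ A → Γ ⊩ Δ' ⊢ A
  𝟙R   : Γ ⊩ [] ⊢ 𝟙
  𝟙L   : ∀ {Δ D} → Γ ⊩ Δ ⊢ D → Γ ⊩ 𝟙 ∷ Δ ⊢ D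
  ⊗R   : ∀ {Δ₁ Δ₂ A B} → Γ ⊩ Δ₁ ⊢ A → Γ ⊩ Δ₂ ⊢ B → Γ ⊩ Δ₁ ++ Δ₂ ⊢ A ⊗ B
  ⊗L   : ∀ {Δ A B D} → Γ ⊩ A ∷ B ∷ Δ ⊢ D → Γ ⊩ A ⊗ B ∷ Δ ⊢ D
  ⊸R   : ∀ {Δ A B} → Γ ⊩ A ∷ Δ ⊢ B → Γ ⊩ Δ ⊢ A ⊸ B
  ⊸L   : ∀ {Δ₁ Δ₂ A B D} → Γ ⊩ Δ₁ ⊢ A → Γ ⊩ B ∷ Δ₂ ⊢ D →
         Γ ⊩ (A ⊸ B) ∷ (Δ₁ ++ Δ₂) ⊢ D
  ⊤R   : ∀ {Δ} → Γ ⊩ Δ ⊢ ⊤'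
  &R   : ∀ {Δ A B} → Γ ⊩ Δ ⊢ A → Γ ⊩ Δ ⊢ B → Γ ⊩ Δ ⊢ A & B
  &L₁  : ∀ {Δ A B D} → Γ ⊩ A ∷ Δ ⊢ D → Γ ⊩ A & B ∷ Δ ⊢ D
  &L₂  : ∀ {Δ A B D} → Γ ⊩ B ∷ Δ ⊢ D → Γ ⊩ A & B ∷ Δ ⊢ D
  𝟘L   : ∀ {Δ D} → Γ ⊩ 𝟘 ∷ Δ ⊢ D
  ⊕R₁  : ∀ {Δ A B} → Γ ⊩ Δ ⊢ A → Γ ⊩ Δ ⊢ A ⊕ B
  ⊕R₂  : ∀ {Δ A B} → Γ ⊩ Δ ⊢ B → Γ ⊩ Δ ⊢ A ⊕ B
  ⊕L   : ∀ {Δ A B D} → Γ ⊩ A ∷ Δ ⊢ D → Γ ⊩ B ∷ Δ ⊢ D → Γ ⊩ A ⊕ B ∷ Δ ⊢ D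
  !W   : ∀ {Δ A D} → Γ ⊩ Δ ⊢ D → Γ ⊩ ! A ∷ Δ ⊢ D
  !C   : ∀ {Δ A D} → Γ ⊩ ! A ∷ ! A ∷ Δ ⊢ D → Γ ⊩ ! A ∷ Δ ⊢ D
  !D   : ∀ {Δ A D} → Γ ⊩ A ∷ Δ ⊢ D → Γ ⊩ ! A ∷ Δ ⊢ D
  !R   : ∀ {Δ A} → Γ ⊩ map !_ Δ ⊢ A → Γ ⊩ map !_ Δ ⊢ ! A
  -- quantifiers (eigenvariable = the newly bound de Bruijn variable)
  ∀R   : ∀ {Δ σ A} → (σ ∷ Γ) ⊩ map wkL Δ ⊢ A → Γ ⊩ Δ ⊢ all σ A
  ∀L   : ∀ {Δ σ A D} (t : Tm Γ σ) → Γ ⊩ A [ t ]L ∷ Δ ⊢ D → Γ ⊩ all σ A ∷ Δ ⊢ D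
  ∃R   : ∀ {Δ σ A} (t : Tm Γ σ) → Γ ⊩ Δ ⊢ A [ t ]L → Γ ⊩ Δ ⊢ ex σ A
  ∃L   : ∀ {Δ σ A D} → (σ ∷ Γ) ⊩ A ∷ map wkL Δ ⊢ wkL D → Γ ⊩ ex σ A ∷ Δ ⊢ D
  eq-refl  : ∀ {σ} (b : Base σ) (t : Tm Γ σ) → Γ ⊩ [] ⊢ atom (eq b t t)
  eq-subst : ∀ {σ} (b : Base σ) (s t : Tm Γ σ) (A : LFm (σ ∷ Γ)) →
             Γ ⊩ ! atom (eq b s t) ∷ A [ s ]L ∷ [] ⊢ A [ t ]L
  T≠F      : Γ ⊩ atom (eq 𝔹 tt ff) ∷ [] ⊢ 𝟘
  bool-cases : (z : Tm Γ 𝔹) →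
             Γ ⊩ [] ⊢ (! atom (eq 𝔹 z tt)) ⊕ (! atom (eq 𝔹 z ff))
  cond-T   : ∀ {σ} (b : Base σ) (s t : Tm Γ σ) → Γ ⊩ [] ⊢ atom (eq b (cond tt s t) s)
  cond-F   : ∀ {σ} (b : Base σ) (s t : Tm Γ σ) → Γ ⊩ [] ⊢ atom (eq b (cond ff s t) t)

module Submission where

-- With the Dialectica-style clause |!A|ˣ_y :≡ !|A|ˣ_y the
-- interpretation of A⁺ is not merely equivalent to (A_D(x;y))⁺, it is the
-- very same linear formula: both are computed clause by clause, the clause
-- for ⊕ is literally the ⁺-image of the Dialectica disjunction, and the
-- clause for (!A⁺ ⊸ B⁺) is the ⁺-image of A_D ⊃ B_D.  The theorem is then
-- an instance of the identity equivalence P ⊸ P & P ⊸ P.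
--
-- The only work is bookkeeping about tuples: the witness and challenge
-- types of A⁺ and A^D are equal but not definitionally, so tuples are
-- transported along list equalities (castW, castC).

open import Defs
open import Data.List using (List; []; _∷_; _++_; map; [_])
open import Data.List.Relation.Unary.All using ([]; _∷_)
import Data.List.Properties as ListProps
open import Data.Product using (_,_)
open import Relation.Binary.PropositionalEquality
  using (_≡_; refl; sym; trans; cong; cong₂; subst; module ≡-Reasoning)
open import Relation.Binary.Definitions using (DecidableEquality)
open import Relation.Nullary using (yes; no)
open import Axiom.UniquenessOfIdentityProofs using (module Decidable⇒UIP)

_≟Ty_ : DecidableEquality Ty
ι ≟Ty ι = yes refl
ι ≟Ty 𝔹 = no λ ()
ι ≟Ty (_ ⇒ _) = no λ ()
𝔹 ≟Ty ι = no λ ()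
𝔹 ≟Ty 𝔹 = yes refl
𝔹 ≟Ty (_ ⇒ _) = no λ ()
(_ ⇒ _) ≟Ty ι = no λ ()
(_ ⇒ _) ≟Ty 𝔹 = no λ ()
(σ ⇒ τ) ≟Ty (σ' ⇒ τ') with σ ≟Ty σ' | τ ≟Ty τ'
... | yes refl | yes refl = yes refl
... | no σ≢σ'  | _        = no λ { refl → σ≢σ' refl }
... | yes _    | no τ≢τ'  = no λ { refl → τ≢τ' refl }

-- Hedberg: lists of types have decidable equality, hence unique identity
-- proofs.  This is what lets us ignore how W⁺ and C⁺ were proved.
uip : {Xs Ys : List Ty} (p q : Xs ≡ Ys) → p ≡ q
uip = Decidable⇒UIP.≡-irrelevant (ListProps.≡-dec _≟Ty_)

data Split {Γ} (Xs Ys : List Ty) : Tms Γ (Xs ++ Ys) → Set where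
  _++ᵛ_ : (a : Tms Γ Xs) (b : Tms Γ Ys) → Split Xs Ys (a ++ᵗ b)

split-view : ∀ {Γ} Xs {Ys} (t : Tms Γ (Xs ++ Ys)) → Split Xs Ys t
split-view []       t       = [] ++ᵛ t
split-view (X ∷ Xs) (u ∷ t) with split-view Xs t
... | a ++ᵛ b = (u ∷ a) ++ᵛ b

split-++ : ∀ {Γ} Xs {Ys} (a : Tms Γ Xs) (b : Tms Γ Ys) → split Xs (a ++ᵗ b) ≡ (a , b)
split-++ []       []      b = refl
split-++ (X ∷ Xs) (u ∷ a) b rewrite split-++ Xs a b = refl

⇒*-cong : {Xs Xs' Ys Ys' : List Ty} → Xs ≡ Xs' → Ys ≡ Ys' → map (Xs ⇒*_) Ys ≡ map (Xs' ⇒*_) Ys'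
⇒*-cong = cong₂ (λ Xs Ys → map (Xs ⇒*_) Ys)

module Transport {Γ : Ctx} where

  tr : {Xs Ys : List Ty} → Xs ≡ Ys → Tms Γ Xs → Tms Γ Ys
  tr = subst (Tms Γ)

  tr⇒ : {Xs Xs' Ys Ys' : List Ty} → Xs ≡ Xs' → Ys ≡ Ys' →
        Tms Γ (map (Xs ⇒*_) Ys) → Tms Γ (map (Xs' ⇒*_) Ys')
  tr⇒ p q = tr (⇒*-cong p q)

  tr-++ : {Xs Ys Xs' Ys' : List Ty} (e₁ : Xs ≡ Xs') (e₂ : Ys ≡ Ys') {e : Xs ++ Ys ≡ Xs' ++ Ys'}
          (a : Tms Γ Xs) (b : Tms Γ Ys) → tr e (a ++ᵗ b) ≡ tr e₁ a ++ᵗ tr e₂ b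
  tr-++ refl refl {e} a b = cong (λ e → tr e (a ++ᵗ b)) (uip e refl)

  tr-irrelevant : {Xs Ys : List Ty} {e e' : Xs ≡ Ys} (a : Tms Γ Xs) → tr e a ≡ tr e' a
  tr-irrelevant {e = e} {e'} a = cong (λ e → tr e a) (uip e e')

  tr⇒-apply : {Xs Xs' Ys Ys' : List Ty} (p : Xs ≡ Xs') (q : Ys ≡ Ys')
              (f : Tms Γ (map (Xs ⇒*_) Ys)) (x : Tms Γ Xs) →
              applyTup Xs' Ys' (tr⇒ p q f) (tr p x) ≡ tr q (applyTup Xs Ys f x)
  tr⇒-apply refl refl f x = refl

tr-wk : ∀ {Γ τ} {Xs Ys : List Ty} (e : Xs ≡ Ys) (a : Tms Γ Xs) →
        wkTms {τ = τ} (Transport.tr e a) ≡ Transport.tr e (wkTms a)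
tr-wk refl a = refl

open Transport

wit : ∀ {Γ} (A : Fm Γ) → D⁺ A ≡ W (A ⁺)
wit A = sym (W⁺ A)

cha : ∀ {Γ} (A : Fm Γ) → D⁻ A ≡ C (A ⁺)
cha A = sym (C⁺ A)

⁺-sub : ∀ {Γ Δ} (s : Sub Γ Δ) (A : Fm Γ) → (subF s A) ⁺ ≡ subL s (A ⁺)
⁺-sub s (atom a)  = refl
⁺-sub s ⊥'        = refl
⁺-sub s (A ∧ B)   = cong₂ _&_ (⁺-sub s A) (⁺-sub s B)
⁺-sub s (A ∨ B)   = cong₂ _⊕_ (⁺-sub s A) (⁺-sub s B)
⁺-sub s (A ⊃ B)   = cong₂ (λ P Q → (! P) ⊸ Q) (⁺-sub s A) (⁺-sub s B)
⁺-sub s (all σ A) = cong (all σ) (⁺-sub (extS s) A)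
⁺-sub s (ex σ A)  = cong (ex σ) (⁺-sub (extS s) A)

module _ {Γ : Ctx} where

  ∣&∣ : (P Q : LFm Γ) (x : Tms Γ (W P)) (v : Tms Γ (W Q)) (y : Tms Γ (C P)) (w : Tms Γ (C Q)) →
        ∣ P & Q ∣ (x ++ᵗ v) (y ++ᵗ w) ≡ ∣ P ∣ x y & ∣ Q ∣ v w
  ∣&∣ P Q x v y w rewrite split-++ (W P) x v | split-++ (C P) y w = refl

  ∣⊕∣ : (P Q : LFm Γ) (x : Tms Γ (W P)) (v : Tms Γ (W Q)) (z : Tm Γ 𝔹)
        (y : Tms Γ (C P)) (w : Tms Γ (C Q)) →
        ∣ P ⊕ Q ∣ (x ++ᵗ (v ++ᵗ (z ∷ []))) (y ++ᵗ w) ≡ cond z ⟨ ∣ P ∣ x y , ∣ Q ∣ v w ⟩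
  ∣⊕∣ P Q x v z y w
    rewrite split-++ (W P) x (v ++ᵗ (z ∷ [])) | split-++ (C P) y w | split-++ (W Q) v (z ∷ [])
    = refl

  ∣⊸∣ : (P Q : LFm Γ) (f : Tms Γ (map ((W P ++ C Q) ⇒*_) (C P))) (g : Tms Γ (map (W P ⇒*_) (W Q)))
        (x : Tms Γ (W P)) (w : Tms Γ (C Q)) →
        ∣ P ⊸ Q ∣ (f ++ᵗ g) (x ++ᵗ w)
          ≡ ∣ P ∣ x (applyTup (W P ++ C Q) (C P) f (x ++ᵗ w)) ⊸ ∣ Q ∣ (applyTup (W P) (W Q) g x) w
  ∣⊸∣ P Q f g x w
    rewrite split-++ (map ((W P ++ C Q) ⇒*_) (C P)) f g | split-++ (W P) x w = refl

  ∣∀∣ : ∀ {σ} (P : LFm (σ ∷ Γ)) (f : Tms Γ (map ([ σ ] ⇒*_) (W P))) (y : Tms Γ (C P)) (z : Tm Γ σ) →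
        ∣ all σ P ∣ f (y ++ᵗ (z ∷ []))
          ≡ (∣ P ∣ (applyTup [ σ ] (W P) (wkTms f) (var here ∷ [])) (wkTms y)) [ z ]L
  ∣∀∣ P f y z rewrite split-++ (C P) y (z ∷ []) = refl

  ∣∃∣ : ∀ {σ} (P : LFm (σ ∷ Γ)) (x : Tms Γ (W P)) (z : Tm Γ σ) (y : Tms Γ (C P)) →
        ∣ ex σ P ∣ (x ++ᵗ (z ∷ [])) y ≡ (∣ P ∣ (wkTms x) (wkTms y)) [ z ]L
  ∣∃∣ P x z y rewrite split-++ (W P) x (z ∷ []) = refl

module _ {Γ : Ctx} where

  D∧ : (A B : Fm Γ) (x : Tms Γ (D⁺ A)) (v : Tms Γ (D⁺ B)) (y : Tms Γ (D⁻ A)) (w : Tms Γ (D⁻ B)) →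
       (A ∧ B) D[ x ++ᵗ v ⨾ y ++ᵗ w ] ≡ A D[ x ⨾ y ] ∧ B D[ v ⨾ w ]
  D∧ A B x v y w rewrite split-++ (D⁺ A) x v | split-++ (D⁻ A) y w = refl

  D∨ : (A B : Fm Γ) (x : Tms Γ (D⁺ A)) (v : Tms Γ (D⁺ B)) (z : Tm Γ 𝔹)
       (y : Tms Γ (D⁻ A)) (w : Tms Γ (D⁻ B)) →
       (A ∨ B) D[ x ++ᵗ (v ++ᵗ (z ∷ [])) ⨾ y ++ᵗ w ]
         ≡ (atom (eq 𝔹 z tt) ⊃ A D[ x ⨾ y ]) ∧ (atom (eq 𝔹 z ff) ⊃ B D[ v ⨾ w ])
  D∨ A B x v z y w
    rewrite split-++ (D⁺ A) x (v ++ᵗ (z ∷ [])) | split-++ (D⁻ A) y w | split-++ (D⁺ B) v (z ∷ [])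
    = refl

  D⊃ : (A B : Fm Γ) (f : Tms Γ (map ((D⁺ A ++ D⁻ B) ⇒*_) (D⁻ A))) (g : Tms Γ (map (D⁺ A ⇒*_) (D⁺ B)))
       (x : Tms Γ (D⁺ A)) (w : Tms Γ (D⁻ B)) →
       (A ⊃ B) D[ f ++ᵗ g ⨾ x ++ᵗ w ]
         ≡ A D[ x ⨾ applyTup (D⁺ A ++ D⁻ B) (D⁻ A) f (x ++ᵗ w) ]
             ⊃ B D[ applyTup (D⁺ A) (D⁺ B) g x ⨾ w ]
  D⊃ A B f g x w
    rewrite split-++ (map ((D⁺ A ++ D⁻ B) ⇒*_) (D⁻ A)) f g | split-++ (D⁺ A) x w = refl

  D∀ : ∀ {σ} (A : Fm (σ ∷ Γ)) (f : Tms Γ (map ([ σ ] ⇒*_) (D⁺ A))) (y : Tms Γ (D⁻ A)) (z : Tm Γ σ) →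
       all σ A D[ f ⨾ y ++ᵗ (z ∷ []) ]
         ≡ (A D[ applyTup [ σ ] (D⁺ A) (wkTms f) (var here ∷ []) ⨾ wkTms y ]) [ z ]F
  D∀ A f y z rewrite split-++ (D⁻ A) y (z ∷ []) = refl

  D∃ : ∀ {σ} (A : Fm (σ ∷ Γ)) (x : Tms Γ (D⁺ A)) (z : Tm Γ σ) (y : Tms Γ (D⁻ A)) →
       ex σ A D[ x ++ᵗ (z ∷ []) ⨾ y ] ≡ (A D[ wkTms x ⨾ wkTms y ]) [ z ]F
  D∃ A x z y rewrite split-++ (D⁺ A) x (z ∷ []) = refl

Agrees : ∀ {Γ} → Fm Γ → Set
Agrees A = ∀ x y → ∣ A ⁺ ∣ (castW A x) (castC A y) ≡ (A D[ x ⨾ y ]) ⁺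

module _ {Γ : Ctx} where
  open ≡-Reasoning

  agrees-∧ : (A B : Fm Γ) → Agrees A → Agrees B → Agrees (A ∧ B)
  agrees-∧ A B agA agB x y with split-view (D⁺ A) x | split-view (D⁻ A) y
  ... | a ++ᵛ b | c ++ᵛ d = begin
      ∣ A ⁺ & B ⁺ ∣ (castW (A ∧ B) (a ++ᵗ b)) (castC (A ∧ B) (c ++ᵗ d))
    ≡⟨ cong₂ ∣ A ⁺ & B ⁺ ∣ (tr-++ (wit A) (wit B) a b) (tr-++ (cha A) (cha B) c d) ⟩
      ∣ A ⁺ & B ⁺ ∣ (castW A a ++ᵗ castW B b) (castC A c ++ᵗ castC B d)
    ≡⟨ ∣&∣ (A ⁺) (B ⁺) (castW A a) (castW B b) (castC A c) (castC B d) ⟩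
      ∣ A ⁺ ∣ (castW A a) (castC A c) & ∣ B ⁺ ∣ (castW B b) (castC B d)
    ≡⟨ cong₂ _&_ (agA a c) (agB b d) ⟩
      (A D[ a ⨾ c ]) ⁺ & (B D[ b ⨾ d ]) ⁺
    ≡⟨ cong _⁺ (sym (D∧ A B a b c d)) ⟩
      ((A ∧ B) D[ a ++ᵗ b ⨾ c ++ᵗ d ]) ⁺
    ∎

  -- The clause for ⊕ is cond, i.e. exactly the ⁺-image of the Dialectica
  -- disjunction (z = T → A_D) ∧ (z = F → B_D).
  agrees-∨ : (A B : Fm Γ) → Agrees A → Agrees B → Agrees (A ∨ B)
  agrees-∨ A B agA agB x y with split-view (D⁺ A) x | split-view (D⁻ A) y
  ... | a ++ᵛ vz | c ++ᵛ d with split-view (D⁺ B) vz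
  ... | b ++ᵛ (z ∷ []) = begin
      ∣ A ⁺ ⊕ B ⁺ ∣ (castW (A ∨ B) (a ++ᵗ (b ++ᵗ (z ∷ [])))) (castC (A ∨ B) (c ++ᵗ d))
    ≡⟨ cong₂ ∣ A ⁺ ⊕ B ⁺ ∣ castW-∨ (tr-++ (cha A) (cha B) c d) ⟩
      ∣ A ⁺ ⊕ B ⁺ ∣ (castW A a ++ᵗ (castW B b ++ᵗ (z ∷ []))) (castC A c ++ᵗ castC B d)
    ≡⟨ ∣⊕∣ (A ⁺) (B ⁺) (castW A a) (castW B b) z (castC A c) (castC B d) ⟩
      cond z ⟨ ∣ A ⁺ ∣ (castW A a) (castC A c) , ∣ B ⁺ ∣ (castW B b) (castC B d) ⟩
    ≡⟨ cong₂ cond z ⟨_,_⟩ (agA a c) (agB b d) ⟩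
      cond z ⟨ (A D[ a ⨾ c ]) ⁺ , (B D[ b ⨾ d ]) ⁺ ⟩
    ≡⟨ cong _⁺ (sym (D∨ A B a b z c d)) ⟩
      ((A ∨ B) D[ a ++ᵗ (b ++ᵗ (z ∷ [])) ⨾ c ++ᵗ d ]) ⁺
    ∎
    where
    castW-∨ : castW (A ∨ B) (a ++ᵗ (b ++ᵗ (z ∷ []))) ≡ castW A a ++ᵗ (castW B b ++ᵗ (z ∷ []))
    castW-∨ = trans (tr-++ (wit A) (cong (_++ [ 𝔹 ]) (wit B)) a (b ++ᵗ (z ∷ [])))
                    (cong (castW A a ++ᵗ_) (tr-++ (wit B) refl b (z ∷ [])))

  -- Since |!P| = !|P|, the clause for !A⁺ ⊸ B⁺ is the ⁺-image of A_D ⊃ B_D;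
  -- the transported functionals compute the transported counter-examples.
  agrees-⊃ : (A B : Fm Γ) → Agrees A → Agrees B → Agrees (A ⊃ B)
  agrees-⊃ A B agA agB fg xw
    with split-view (map ((D⁺ A ++ D⁻ B) ⇒*_) (D⁻ A)) fg | split-view (D⁺ A) xw
  ... | f ++ᵛ g | x ++ᵛ w = begin
      ∣ (! (A ⁺)) ⊸ B ⁺ ∣ (castW (A ⊃ B) (f ++ᵗ g)) (castC (A ⊃ B) (x ++ᵗ w))
    ≡⟨ cong₂ ∣ (! (A ⁺)) ⊸ B ⁺ ∣ (tr-++ (⇒*-cong argsA (cha A)) (⇒*-cong (wit A) (wit B)) f g)
             (tr-++ (wit A) (cha B) x w) ⟩
      ∣ (! (A ⁺)) ⊸ B ⁺ ∣ (f' ++ᵗ g') (castW A x ++ᵗ castC B w)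
    ≡⟨ ∣⊸∣ (! (A ⁺)) (B ⁺) f' g' (castW A x) (castC B w) ⟩
      (! ∣ A ⁺ ∣ (castW A x) (applyTup (W (A ⁺) ++ C (B ⁺)) (C (A ⁺)) f' (castW A x ++ᵗ castC B w)))
        ⊸ ∣ B ⁺ ∣ (applyTup (W (A ⁺)) (W (B ⁺)) g' (castW A x)) (castC B w)
    ≡⟨ cong₂ (λ u v → (! ∣ A ⁺ ∣ (castW A x) u) ⊸ ∣ B ⁺ ∣ v (castC B w))
             counterexample (tr⇒-apply (wit A) (wit B) g x) ⟩
      (! ∣ A ⁺ ∣ (castW A x) (castC A fx)) ⊸ ∣ B ⁺ ∣ (castW B gx) (castC B w)
    ≡⟨ cong₂ (λ P Q → (! P) ⊸ Q) (agA x fx) (agB gx w) ⟩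
      (! ((A D[ x ⨾ fx ]) ⁺)) ⊸ (B D[ gx ⨾ w ]) ⁺
    ≡⟨ cong _⁺ (sym (D⊃ A B f g x w)) ⟩
      ((A ⊃ B) D[ f ++ᵗ g ⨾ x ++ᵗ w ]) ⁺
    ∎
    where
    argsA : D⁺ A ++ D⁻ B ≡ W (A ⁺) ++ C (B ⁺)
    argsA = cong₂ _++_ (wit A) (cha B)
    f' : Tms Γ (map ((W (A ⁺) ++ C (B ⁺)) ⇒*_) (C (A ⁺)))
    f' = tr⇒ argsA (cha A) f
    g' : Tms Γ (map (W (A ⁺) ⇒*_) (W (B ⁺)))
    g' = tr⇒ (wit A) (wit B) g
    fx : Tms Γ (D⁻ A)
    fx = applyTup (D⁺ A ++ D⁻ B) (D⁻ A) f (x ++ᵗ w)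
    gx : Tms Γ (D⁺ B)
    gx = applyTup (D⁺ A) (D⁺ B) g x
    counterexample : applyTup (W (A ⁺) ++ C (B ⁺)) (C (A ⁺)) f' (castW A x ++ᵗ castC B w) ≡ castC A fx
    counterexample = trans (cong (applyTup _ _ f') (sym (tr-++ (wit A) (cha B) x w)))
                           (tr⇒-apply argsA (cha A) f (x ++ᵗ w))

  agrees-∀ : ∀ {σ} (A : Fm (σ ∷ Γ)) → Agrees A → Agrees (all σ A)
  agrees-∀ {σ} A agA f yz with split-view (D⁻ A) yz
  ... | y ++ᵛ (z ∷ []) = begin
      ∣ all σ (A ⁺) ∣ (castW (all σ A) f) (castC (all σ A) (y ++ᵗ (z ∷ [])))
    ≡⟨ cong₂ ∣ all σ (A ⁺) ∣ (tr-irrelevant f) (tr-++ (cha A) refl y (z ∷ [])) ⟩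
      ∣ all σ (A ⁺) ∣ f' (tr (cha A) y ++ᵗ (z ∷ []))
    ≡⟨ ∣∀∣ (A ⁺) f' (tr (cha A) y) z ⟩
      (∣ A ⁺ ∣ (applyTup [ σ ] (W (A ⁺)) (wkTms f') (var here ∷ [])) (wkTms (tr (cha A) y))) [ z ]L
    ≡⟨ cong₂ (λ u v → (∣ A ⁺ ∣ u v) [ z ]L) body (tr-wk (cha A) y) ⟩
      (∣ A ⁺ ∣ (castW A fσ) (castC A (wkTms y))) [ z ]L
    ≡⟨ cong (_[ z ]L) (agA fσ (wkTms y)) ⟩
      ((A D[ fσ ⨾ wkTms y ]) ⁺) [ z ]L
    ≡⟨ sym (⁺-sub (single z) (A D[ fσ ⨾ wkTms y ])) ⟩
      ((A D[ fσ ⨾ wkTms y ]) [ z ]F) ⁺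
    ≡⟨ cong _⁺ (sym (D∀ A f y z)) ⟩
      (all σ A D[ f ⨾ y ++ᵗ (z ∷ []) ]) ⁺
    ∎
    where
    f' : Tms Γ (map ([ σ ] ⇒*_) (W (A ⁺)))
    f' = tr⇒ refl (wit A) f
    fσ : Tms (σ ∷ Γ) (D⁺ A)
    fσ = applyTup [ σ ] (D⁺ A) (wkTms f) (var here ∷ [])
    body : applyTup [ σ ] (W (A ⁺)) (wkTms f') (var here ∷ []) ≡ castW A fσ
    body = trans (cong (λ h → applyTup [ σ ] (W (A ⁺)) h (var here ∷ [])) (tr-wk _ f))
                 (tr⇒-apply refl (wit A) (wkTms f) (var here ∷ []))

  agrees-∃ : ∀ {σ} (A : Fm (σ ∷ Γ)) → Agrees A → Agrees (ex σ A)
  agrees-∃ {σ} A agA xz y with split-view (D⁺ A) xz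
  ... | x ++ᵛ (z ∷ []) = begin
      ∣ ex σ (A ⁺) ∣ (castW (ex σ A) (x ++ᵗ (z ∷ []))) (tr (cha A) y)
    ≡⟨ cong (λ u → ∣ ex σ (A ⁺) ∣ u (tr (cha A) y)) (tr-++ (wit A) refl x (z ∷ [])) ⟩
      ∣ ex σ (A ⁺) ∣ (tr (wit A) x ++ᵗ (z ∷ [])) (tr (cha A) y)
    ≡⟨ ∣∃∣ (A ⁺) (tr (wit A) x) z (tr (cha A) y) ⟩
      (∣ A ⁺ ∣ (wkTms (tr (wit A) x)) (wkTms (tr (cha A) y))) [ z ]L
    ≡⟨ cong₂ (λ u v → (∣ A ⁺ ∣ u v) [ z ]L) (tr-wk (wit A) x) (tr-wk (cha A) y) ⟩
      (∣ A ⁺ ∣ (castW A (wkTms x)) (castC A (wkTms y))) [ z ]L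
    ≡⟨ cong (_[ z ]L) (agA (wkTms x) (wkTms y)) ⟩
      ((A D[ wkTms x ⨾ wkTms y ]) ⁺) [ z ]L
    ≡⟨ sym (⁺-sub (single z) (A D[ wkTms x ⨾ wkTms y ])) ⟩
      ((A D[ wkTms x ⨾ wkTms y ]) [ z ]F) ⁺
    ≡⟨ cong _⁺ (sym (D∃ A x z y)) ⟩
      (ex σ A D[ x ++ᵗ (z ∷ []) ⨾ y ]) ⁺
    ∎

agrees : ∀ {Γ} (A : Fm Γ) → Agrees A
agrees (atom a)  [] [] = refl
agrees ⊥'        [] [] = refl
agrees (A ∧ B)   = agrees-∧ A B (agrees A) (agrees B)
agrees (A ∨ B)   = agrees-∨ A B (agrees A) (agrees B)
agrees (A ⊃ B)   = agrees-⊃ A B (agrees A) (agrees B)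
agrees (all σ A) = agrees-∀ A (agrees A)
agrees (ex σ A)  = agrees-∃ A (agrees A)

⊸-self-equivalence : ∀ {Γ} (P : LFm Γ) → Γ ⊩ [] ⊢ (P ⊸ P) & (P ⊸ P)
⊸-self-equivalence P = &R (⊸R ax) (⊸R ax)

-- Theorem 4.5: |A⁺|ˣ_y and (A_D(x;y))⁺ are provably equivalent, because
-- they are the same formula.
theorem4p5 : ∀ {Γ} (A : Fm Γ) (x : Tms Γ (D⁺ A)) (y : Tms Γ (D⁻ A)) →
    Γ ⊩ [] ⊢ (∣ A ⁺ ∣ (castW A x) (castC A y) ⊸ (A D[ x ⨾ y ]) ⁺)
             & ((A D[ x ⨾ y ]) ⁺ ⊸ ∣ A ⁺ ∣ (castW A x) (castC A y))
theorem4p5 A x y rewrite agrees A x y = ⊸-self-equivalence ((A D[ x ⨾ y ]) ⁺)
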